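{- Assume that for every integer $u \ge 1$, every sequence $a_0, \dots, a_{v-1}$ with $a_i \in \{ -1,1\}$ and $v = 4u^2$ whose periodic autocorrelation satisfies $\theta(0) = v$ and $\theta(t) = 0$ for $t \not\equiv 0 \pmod v$ also has aperiodic autocorrelation satisfying $\rho(t) \in \{0, 1, -1\}$ for all $0 < t < v$. Then the number of cyclic Hadamard matrices (of all orders taken together) is finite.
   Context: For a sequence $a_0, \dots, a_{n-1}$ of real numbers, the periodic autocorrelation is $\theta(t) = \sum_{i=0}^{n-1} a_i a_{i+t}$ (indices taken modulo $n$) and the aperiodic autocorrelation is $\rho(t) = \sum_{i=0}^{n-1-t} a_i a_{i+t}$ for $0 \le t < n$. A cyclic Hadamard matrix of order $n$ is an $n \times n$ matrix $H$ with entries in $\{ -1,1\}$ whose rows are the successive cyclic shifts of its first row $(a_0, \dots, a_{n-1})$, and which satisfies $H H^T = n I_n$. -}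

module Defs where

open import Data.Nat using (ℕ; zero; suc; _+_; _*_; _∸_; _<_; _≤_; _%_)
open import Data.Integer using (ℤ; +_; -_) renaming (_+_ to _+ℤ_; _*_ to _*ℤ_)
open import Data.List using (List; map; upTo)
open import Data.List.Relation.Unary.All using (All)
open import Data.Vec using (Vec; []; _∷_)
open import Data.Product using (Σ; _,_; _×_)
open import Data.Sum using (_⊎_)
open import Relation.Binary.PropositionalEquality using (_≡_; _≢_)
import Data.List
import Data.Nat
import Relation.Nullary
import Data.Vec.Relation.Unary.All as VAll

Σ< : ℕ → (ℕ → ℤ) → ℤ
Σ< n f = Data.List.foldr _+ℤ_ (+ 0) (map f (upTo n))

-- k mod n, for n ≥ 1 (the case n = 0 is never used)
modN : ℕ → ℕ → ℕ
modN k zero    = k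
modN k (suc m) = k % suc m

-- lookup by a natural index (only ever used with in-range indices;
-- returns 0 out of range)
at : ∀ {n} → Vec ℤ n → ℕ → ℤ
at []       _       = + 0
at (x ∷ xs) zero    = x
at (x ∷ xs) (suc k) = at xs k

atRow : ∀ {m n} → Vec (Vec ℤ n) m → ℕ → Vec ℤ n
atRow {n = n} []       _       = Data.Vec.replicate n (+ 0)
atRow         (r ∷ rs) zero    = r
atRow         (r ∷ rs) (suc k) = atRow rs k

ent : ∀ {n} → Vec (Vec ℤ n) n → ℕ → ℕ → ℤ
ent M i j = at (atRow M i) j

IsPM : ℤ → Set
IsPM x = x ≡ + 1 ⊎ x ≡ - (+ 1)

PMSeq : (v : ℕ) → Vec ℤ v → Set
PMSeq v a = VAll.All IsPM a

θ : ∀ {v} → Vec ℤ v → ℕ → ℤ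
θ {v} a t = Σ< v (λ i → at a i *ℤ at a (modN (i + t) v))

ρ : ∀ {v} → Vec ℤ v → ℕ → ℤ
ρ {v} a t = Σ< (v ∸ t) (λ i → at a i *ℤ at a (i + t))

δ : ℕ → ℕ → ℤ → ℤ
δ i k z with Data.Nat._≟_ i k
... | Relation.Nullary.yes _ = z
... | Relation.Nullary.no  _ = + 0

Mat : ℕ → Set
Mat n = Vec (Vec ℤ n) n

-- cyclic Hadamard matrix of order n: ±1 entries, rows are the successive
-- cyclic shifts of the first row (H_{i,j} = a_{(j - i) mod n}), and H Hᵀ = n I
IsCyclicHadamard : (n : ℕ) → Mat n → Set
IsCyclicHadamard n H =
  (∀ i j → i < n → j < n → IsPM (ent H i j)) ×
  (∀ i j → i < n → j < n → ent H i j ≡ ent H 0 (modN (j + n ∸ i) n)) ×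
  (∀ i k → i < n → k < n →
     Σ< n (λ j → ent H i j *ℤ ent H k j) ≡ δ i k (+ n))

{-# OPTIONS --safe #-}
module Submission where

-- The periodic extension A of the first row of a cyclic Hadamard matrix of order n is a
-- perfect ±1 sequence: its periodic autocorrelation vanishes at every t ≢ 0 (mod n).
-- Summing all n autocorrelations gives (Σ A)² = n, and the autocorrelation at 1 is a vanishing
-- sum of n signs, so n is even; hence n = 4u². If u ≥ 2, every rotation of A is perfect, so by
-- hypothesis its aperiodic autocorrelation at n − 2, the two-term sum
-- A(s)A(s+n−2) + A(s+1)A(s+n−1), vanishes. Comparing consecutive s forces A to have period 4,
-- and then the autocorrelation at 4 is n instead of 0. So cyclic Hadamard matrices only exist
-- in orders 0, 1 and 4, and each is the circulant of its ±1 first row.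

module CyclicHadamard where

  open import Defs
  open import Data.Empty using (⊥-elim)
  open import Data.Fin using (toℕ)
  open import Data.Integer using (ℤ; +_; -_; _+_; _*_; ∣_∣)
  import Data.Integer.Properties as ℤₚ
  open import Data.Integer.Tactic.RingSolver using (solve-∀)
  open import Data.Nat.Tactic.RingSolver using () renaming (solve-∀ to ℕ-solve-∀)
  open import Data.List using (List; []; _∷_; map; foldr; cartesianProductWith)
  open import Data.List.Membership.Propositional using (_∈_)
  open import Data.List.Membership.Propositional.Properties
    using (∈-map⁺; ∈-cartesianProductWith⁺)
  open import Data.List.Properties using (map-applyUpTo; map-upTo)
  open import Data.List.Relation.Unary.Any using (here; there)
  open import Data.Nat as ℕ using (ℕ; zero; suc; _<_; _≤_; z≤n; s≤s; z<s; s<s; _%_; _/_; _∸_; NonZero)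
  import Data.Nat.Properties as ℕₚ
  open import Data.Nat.DivMod using (m≡m%n+[m/n]*n; [m+n]%n≡m%n; m%n<n; m<n⇒m%n≡m)
  open import Data.Nat.Divisibility using (_∣_; divides)
  open import Data.Nat.Primality using (euclidsLemma; prime[2])
  open import Data.Product using (Σ; ∃; _,_)
  open import Data.Sum using (_⊎_; inj₁; inj₂; reduce)
  open import Data.Vec using (Vec; []; _∷_; tabulate)
  import Data.Vec.Relation.Unary.All as VAll
  open import Data.Vec.Relation.Unary.All.Properties using (tabulate⁺)
  open import Function using (_∘_)
  open import Relation.Nullary using (yes; no; contradiction)
  open import Relation.Binary.PropositionalEquality
  open import Algebra.Properties.AbelianGroup ℤₚ.+-0-abelianGroup using (∙-cancelʳ)
  open import Algebra.Properties.CommutativeSemigroup ℤₚ.+-commutativeSemigroup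
    using () renaming (interchange to +-interchange)
  open import Algebra.Properties.CommutativeSemigroup ℕₚ.+-commutativeSemigroup
    using () renaming (xy∙z≈xz∙y to +-rightComm)
  open ≡-Reasoning

  Σ<-suc : ∀ n (f : ℕ → ℤ) → Σ< (suc n) f ≡ f 0 + Σ< n (f ∘ suc)
  Σ<-suc n f = cong (λ xs → f 0 + foldr _+_ (+ 0) xs)
    (trans (map-applyUpTo suc f n) (sym (map-upTo (f ∘ suc) n)))

  Σ<-snoc : ∀ n (f : ℕ → ℤ) → Σ< (suc n) f ≡ Σ< n f + f n
  Σ<-snoc zero    f = ℤₚ.+-comm (f 0) (+ 0)
  Σ<-snoc (suc n) f = begin
    Σ< (suc (suc n)) f                  ≡⟨ Σ<-suc (suc n) f ⟩
    f 0 + Σ< (suc n) (f ∘ suc)          ≡⟨ cong (_+_ (f 0)) (Σ<-snoc n (f ∘ suc)) ⟩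
    f 0 + (Σ< n (f ∘ suc) + f (suc n))  ≡⟨ ℤₚ.+-assoc (f 0) _ _ ⟨
    f 0 + Σ< n (f ∘ suc) + f (suc n)    ≡⟨ cong (_+ f (suc n)) (Σ<-suc n f) ⟨
    Σ< (suc n) f + f (suc n)            ∎

  Σ<-cong : ∀ n {f g : ℕ → ℤ} → (∀ i → i < n → f i ≡ g i) → Σ< n f ≡ Σ< n g
  Σ<-cong zero    _ = refl
  Σ<-cong (suc n) {f} {g} f≗g = begin
    Σ< (suc n) f          ≡⟨ Σ<-suc n f ⟩
    f 0 + Σ< n (f ∘ suc)  ≡⟨ cong₂ _+_ (f≗g 0 z<s) (Σ<-cong n (λ i i<n → f≗g (suc i) (s<s i<n))) ⟩
    g 0 + Σ< n (g ∘ suc)  ≡⟨ Σ<-suc n g ⟨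
    Σ< (suc n) g          ∎

  Σ<-+ : ∀ n (f g : ℕ → ℤ) → Σ< n (λ i → f i + g i) ≡ Σ< n f + Σ< n g
  Σ<-+ zero    f g = refl
  Σ<-+ (suc n) f g = begin
    Σ< (suc n) (λ i → f i + g i)                          ≡⟨ Σ<-suc n (λ i → f i + g i) ⟩
    f 0 + g 0 + Σ< n (λ i → f (suc i) + g (suc i))        ≡⟨ cong (_+_ (f 0 + g 0)) (Σ<-+ n (f ∘ suc) (g ∘ suc)) ⟩
    f 0 + g 0 + (Σ< n (f ∘ suc) + Σ< n (g ∘ suc))         ≡⟨ +-interchange (f 0) (g 0) _ _ ⟩
    (f 0 + Σ< n (f ∘ suc)) + (g 0 + Σ< n (g ∘ suc))       ≡⟨ cong₂ _+_ (Σ<-suc n f) (Σ<-suc n g) ⟨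
    Σ< (suc n) f + Σ< (suc n) g                           ∎

  Σ<-*ˡ : ∀ n c (f : ℕ → ℤ) → Σ< n (λ i → c * f i) ≡ c * Σ< n f
  Σ<-*ˡ zero    c f = sym (ℤₚ.*-zeroʳ c)
  Σ<-*ˡ (suc n) c f = begin
    Σ< (suc n) (λ i → c * f i)            ≡⟨ Σ<-suc n (λ i → c * f i) ⟩
    c * f 0 + Σ< n (λ i → c * f (suc i))  ≡⟨ cong (_+_ (c * f 0)) (Σ<-*ˡ n c (f ∘ suc)) ⟩
    c * f 0 + c * Σ< n (f ∘ suc)          ≡⟨ ℤₚ.*-distribˡ-+ c (f 0) _ ⟨
    c * (f 0 + Σ< n (f ∘ suc))            ≡⟨ cong (c *_) (Σ<-suc n f) ⟨
    c * Σ< (suc n) f                      ∎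

  Σ<-*ʳ : ∀ n c (f : ℕ → ℤ) → Σ< n (λ i → f i * c) ≡ Σ< n f * c
  Σ<-*ʳ n c f = begin
    Σ< n (λ i → f i * c)  ≡⟨ Σ<-cong n (λ i _ → ℤₚ.*-comm (f i) c) ⟩
    Σ< n (λ i → c * f i)  ≡⟨ Σ<-*ˡ n c f ⟩
    c * Σ< n f            ≡⟨ ℤₚ.*-comm c _ ⟩
    Σ< n f * c            ∎

  Σ<-const : ∀ n c → Σ< n (λ _ → c) ≡ + n * c
  Σ<-const zero    c = refl
  Σ<-const (suc n) c = begin
    Σ< (suc n) (λ _ → c)  ≡⟨ Σ<-suc n (λ _ → c) ⟩
    c + Σ< n (λ _ → c)    ≡⟨ cong (_+_ (c)) (Σ<-const n c) ⟩
    c + + n * c           ≡⟨ cong (_+ + n * c) (ℤₚ.*-identityˡ c) ⟨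
    + 1 * c + + n * c     ≡⟨ ℤₚ.*-distribʳ-+ c (+ 1) (+ n) ⟨
    + suc n * c           ∎

  Σ<-0 : ∀ n → Σ< n (λ _ → + 0) ≡ + 0
  Σ<-0 n = trans (Σ<-const n (+ 0)) (ℤₚ.*-zeroʳ (+ n))

  Σ<-swap : ∀ m n (f : ℕ → ℕ → ℤ) →
            Σ< m (λ i → Σ< n (f i)) ≡ Σ< n (λ j → Σ< m (λ i → f i j))
  Σ<-swap zero    n f = sym (Σ<-0 n)
  Σ<-swap (suc m) n f = begin
    Σ< (suc m) (λ i → Σ< n (f i))                       ≡⟨ Σ<-suc m (λ i → Σ< n (f i)) ⟩
    Σ< n (f 0) + Σ< m (λ i → Σ< n (f (suc i)))          ≡⟨ cong (_+_ (Σ< n (f 0))) (Σ<-swap m n (f ∘ suc)) ⟩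
    Σ< n (f 0) + Σ< n (λ j → Σ< m (λ i → f (suc i) j))  ≡⟨ Σ<-+ n (f 0) _ ⟨
    Σ< n (λ j → f 0 j + Σ< m (λ i → f (suc i) j))       ≡⟨ Σ<-cong n (λ j _ → Σ<-suc m (λ i → f i j)) ⟨
    Σ< n (λ j → Σ< (suc m) (λ i → f i j))               ∎

  Periodic : ℕ → (ℕ → ℤ) → Set
  Periodic n f = ∀ i → f (i ℕ.+ n) ≡ f i

  Σ<-shift : ∀ n (f : ℕ → ℤ) → f n ≡ f 0 → Σ< n (f ∘ suc) ≡ Σ< n f
  Σ<-shift n f fn≡f0 = ∙-cancelʳ (f 0) _ _ (begin
    Σ< n (f ∘ suc) + f 0  ≡⟨ ℤₚ.+-comm _ (f 0) ⟩
    f 0 + Σ< n (f ∘ suc)  ≡⟨ Σ<-suc n f ⟨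
    Σ< (suc n) f          ≡⟨ Σ<-snoc n f ⟩
    Σ< n f + f n          ≡⟨ cong (_+_ (Σ< n f)) fn≡f0 ⟩
    Σ< n f + f 0          ∎)

  Σ<-rotate : ∀ n {f : ℕ → ℤ} → Periodic n f → ∀ s → Σ< n (λ i → f (i ℕ.+ s)) ≡ Σ< n f
  Σ<-rotate n {f} per zero    = Σ<-cong n (λ i _ → cong f (ℕₚ.+-identityʳ i))
  Σ<-rotate n {f} per (suc s) = begin
    Σ< n (λ i → f (i ℕ.+ suc s))  ≡⟨ Σ<-cong n (λ i _ → cong f (ℕₚ.+-suc i s)) ⟩
    Σ< n (λ i → f (suc i ℕ.+ s))  ≡⟨ Σ<-rotate n (per ∘ suc) s ⟩
    Σ< n (f ∘ suc)                ≡⟨ Σ<-shift n f (per 0) ⟩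
    Σ< n f                        ∎

  pm-parity-step : ∀ {x} S c → IsPM x → ∃ λ c′ → + 1 + (S + + 2 * + c) ≡ x + S + + 2 * + c′
  pm-parity-step S c (inj₁ refl) = c , sym (ℤₚ.+-assoc (+ 1) S _)
  pm-parity-step S c (inj₂ refl) = suc c , flip-one S (+ c)
    where
    flip-one : ∀ S c → + 1 + (S + + 2 * c) ≡ - (+ 1) + S + + 2 * (+ 1 + c)
    flip-one = solve-∀

  Σ<-pm-parity : ∀ n (f : ℕ → ℤ) → (∀ i → i < n → IsPM (f i)) → ∃ λ c → + n ≡ Σ< n f + + 2 * + c
  Σ<-pm-parity zero    f pm = 0 , refl
  Σ<-pm-parity (suc n) f pm with Σ<-pm-parity n (f ∘ suc) (λ i i<n → pm (suc i) (s<s i<n))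
  ... | c , n≡ with pm-parity-step (Σ< n (f ∘ suc)) c (pm 0 z<s)
  ... | c′ , step = c′ , (begin
    + 1 + + n                           ≡⟨ cong (_+_ (+ 1)) n≡ ⟩
    + 1 + (Σ< n (f ∘ suc) + + 2 * + c)  ≡⟨ step ⟩
    f 0 + Σ< n (f ∘ suc) + + 2 * + c′   ≡⟨ cong (_+ + 2 * + c′) (Σ<-suc n f) ⟨
    Σ< (suc n) f + + 2 * + c′           ∎)

  Σ<-pm≡0⇒even : ∀ n (f : ℕ → ℤ) → (∀ i → i < n → IsPM (f i)) → Σ< n f ≡ + 0 → 2 ∣ n
  Σ<-pm≡0⇒even n f pm Σ≡0 with Σ<-pm-parity n f pm
  ... | c , n≡ = divides c (begin
    n                       ≡⟨ cong ∣_∣ n≡ ⟩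
    ∣ Σ< n f + + 2 * + c ∣  ≡⟨ cong (λ x → ∣ x + + 2 * + c ∣) Σ≡0 ⟩
    ∣ + 0 + + 2 * + c ∣     ≡⟨ cong ∣_∣ (ℤₚ.+-identityˡ (+ 2 * + c)) ⟩
    ∣ + 2 * + c ∣           ≡⟨ ℤₚ.abs-* (+ 2) (+ c) ⟩
    2 ℕ.* c                 ≡⟨ ℕₚ.*-comm 2 c ⟩
    c ℕ.* 2                 ∎)

  pm-square : ∀ {x} → IsPM x → x * x ≡ + 1
  pm-square (inj₁ refl) = refl
  pm-square (inj₂ refl) = refl

  pm-* : ∀ {x y} → IsPM x → IsPM y → IsPM (x * y)
  pm-* (inj₁ refl) (inj₁ refl) = inj₁ refl
  pm-* (inj₁ refl) (inj₂ refl) = inj₂ refl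
  pm-* (inj₂ refl) (inj₁ refl) = inj₂ refl
  pm-* (inj₂ refl) (inj₂ refl) = inj₁ refl

  pm-cancelˡ : ∀ {x} y z → IsPM x → x * y ≡ x * z → y ≡ z
  pm-cancelˡ y z (inj₁ refl) = ℤₚ.*-cancelˡ-≡ (+ 1) y z
  pm-cancelˡ y z (inj₂ refl) = ℤₚ.*-cancelˡ-≡ (- (+ 1)) y z

  ∣_∣≤1 : ℤ → Set
  ∣ x ∣≤1 = x ≡ + 0 ⊎ x ≡ + 1 ⊎ x ≡ - (+ 1)

  pm+pm-∣∣≤1⇒≡0 : ∀ {x y} → IsPM x → IsPM y → ∣ x + y ∣≤1 → x + y ≡ + 0
  pm+pm-∣∣≤1⇒≡0 (inj₁ refl) (inj₂ refl) _                  = refl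
  pm+pm-∣∣≤1⇒≡0 (inj₂ refl) (inj₁ refl) _                  = refl
  pm+pm-∣∣≤1⇒≡0 (inj₁ refl) (inj₁ refl) (inj₁ ())
  pm+pm-∣∣≤1⇒≡0 (inj₁ refl) (inj₁ refl) (inj₂ (inj₁ ()))
  pm+pm-∣∣≤1⇒≡0 (inj₁ refl) (inj₁ refl) (inj₂ (inj₂ ()))
  pm+pm-∣∣≤1⇒≡0 (inj₂ refl) (inj₂ refl) (inj₁ ())
  pm+pm-∣∣≤1⇒≡0 (inj₂ refl) (inj₂ refl) (inj₂ (inj₁ ()))
  pm+pm-∣∣≤1⇒≡0 (inj₂ refl) (inj₂ refl) (inj₂ (inj₂ ()))

  -- The relations at j and j + 1 share the term A(j+3)A(j+1), so A(j+2)A(j) = A(j+4)A(j+2).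
  pm-period4 : ∀ {A : ℕ → ℤ} → (∀ i → IsPM (A i)) →
               (∀ j → A (2 ℕ.+ j) * A j + A (3 ℕ.+ j) * A (1 ℕ.+ j) ≡ + 0) → Periodic 4 A
  pm-period4 {A} pm rel j = sym (pm-cancelˡ (A j) (A (j ℕ.+ 4)) (pm (2 ℕ.+ j)) (begin
    A (2 ℕ.+ j) * A j            ≡⟨ ∙-cancelʳ b _ _ (trans (rel j) (sym (trans (ℤₚ.+-comm _ b) (rel (suc j))))) ⟩
    A (4 ℕ.+ j) * A (2 ℕ.+ j)    ≡⟨ ℤₚ.*-comm (A (4 ℕ.+ j)) _ ⟩
    A (2 ℕ.+ j) * A (4 ℕ.+ j)    ≡⟨ cong (λ k → A (2 ℕ.+ j) * A k) (ℕₚ.+-comm 4 j) ⟩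
    A (2 ℕ.+ j) * A (j ℕ.+ 4)    ∎))
    where
    b : ℤ
    b = A (3 ℕ.+ j) * A (1 ℕ.+ j)

  autocorr : ℕ → (ℕ → ℤ) → ℕ → ℤ
  autocorr n A t = Σ< n (λ i → A i * A (i ℕ.+ t))

  -- A perfect ±1 sequence of length n, encoded by its n-periodic extension to all of ℕ.
  record IsPerfect (n : ℕ) (A : ℕ → ℤ) : Set where
    field
      isPM             : ∀ i → IsPM (A i)
      periodic         : Periodic n A
      autocorr-offPeak : ∀ t → 0 < t → t < n → autocorr n A t ≡ + 0

  periodic-0 : ∀ (A : ℕ → ℤ) → Periodic 0 A
  periodic-0 A i = cong A (ℕₚ.+-identityʳ i)

  periodic-+* : ∀ {n A} → Periodic n A → ∀ x k → A (x ℕ.+ k ℕ.* n) ≡ A x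
  periodic-+* {n} {A} per x zero    = cong A (ℕₚ.+-identityʳ x)
  periodic-+* {n} {A} per x (suc k) = begin
    A (x ℕ.+ (n ℕ.+ k ℕ.* n))  ≡⟨ cong A (ℕₚ.+-assoc x n _) ⟨
    A (x ℕ.+ n ℕ.+ k ℕ.* n)    ≡⟨ periodic-+* per (x ℕ.+ n) k ⟩
    A (x ℕ.+ n)                ≡⟨ per x ⟩
    A x                        ∎

  periodic-% : ∀ {n A} .{{_ : NonZero n}} → Periodic n A → ∀ x y → A (x % n ℕ.+ y) ≡ A (x ℕ.+ y)
  periodic-% {n} {A} per x y = begin
    A (x % n ℕ.+ y)                  ≡⟨ periodic-+* per (x % n ℕ.+ y) (x / n) ⟨
    A (x % n ℕ.+ y ℕ.+ x / n ℕ.* n)  ≡⟨ cong A (+-rightComm (x % n) y _) ⟩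
    A (x % n ℕ.+ x / n ℕ.* n ℕ.+ y)  ≡⟨ cong (λ z → A (z ℕ.+ y)) (m≡m%n+[m/n]*n x n) ⟨
    A (x ℕ.+ y)                      ∎

  periodic-shift : ∀ {n A} → Periodic n A → ∀ t → Periodic n (λ i → A (i ℕ.+ t))
  periodic-shift {n} {A} per t i = trans (cong A (+-rightComm i n t)) (per (i ℕ.+ t))

  periodic-* : ∀ {n f g} → Periodic n f → Periodic n g → Periodic n (λ i → f i * g i)
  periodic-* per-f per-g i = cong₂ _*_ (per-f i) (per-g i)

  autocorr-period : ∀ n {A t} → (∀ i → IsPM (A i)) → Periodic t A → autocorr n A t ≡ + n
  autocorr-period n {A} {t} pm per = begin
    autocorr n A t    ≡⟨ Σ<-cong n (λ i _ → trans (cong (A i *_) (per i)) (pm-square (pm i))) ⟩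
    Σ< n (λ _ → + 1)  ≡⟨ Σ<-const n (+ 1) ⟩
    + n * + 1         ≡⟨ ℤₚ.*-identityʳ (+ n) ⟩
    + n               ∎

  autocorr-% : ∀ {n A} .{{_ : NonZero n}} → Periodic n A → ∀ t → autocorr n A t ≡ autocorr n A (t % n)
  autocorr-% {n} {A} per t = Σ<-cong n (λ i _ → cong (A i *_) (begin
    A (i ℕ.+ t)      ≡⟨ cong A (ℕₚ.+-comm i t) ⟩
    A (t ℕ.+ i)      ≡⟨ periodic-% per t i ⟨
    A (t % n ℕ.+ i)  ≡⟨ cong A (ℕₚ.+-comm (t % n) i) ⟩
    A (i ℕ.+ t % n)  ∎))

  Σ<-autocorr : ∀ n {A} → Periodic n A → Σ< n (autocorr n A) ≡ Σ< n A * Σ< n A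
  Σ<-autocorr n {A} per = begin
    Σ< n (λ t → Σ< n (λ i → A i * A (i ℕ.+ t)))  ≡⟨ Σ<-swap n n _ ⟩
    Σ< n (λ i → Σ< n (λ t → A i * A (i ℕ.+ t)))  ≡⟨ Σ<-cong n (λ i _ → Σ<-*ˡ n (A i) (λ t → A (i ℕ.+ t))) ⟩
    Σ< n (λ i → A i * Σ< n (λ t → A (i ℕ.+ t)))  ≡⟨ Σ<-cong n (λ i _ → cong (A i *_) (rowSum-rotate i)) ⟩
    Σ< n (λ i → A i * Σ< n A)                    ≡⟨ Σ<-*ʳ n (Σ< n A) A ⟩
    Σ< n A * Σ< n A                              ∎
    where
    rowSum-rotate : ∀ i → Σ< n (λ t → A (i ℕ.+ t)) ≡ Σ< n A
    rowSum-rotate i = trans (Σ<-cong n (λ t _ → cong A (ℕₚ.+-comm i t))) (Σ<-rotate n per i)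

  perfect-rowSum² : ∀ {n A} → IsPerfect n A → Σ< n A * Σ< n A ≡ + n
  perfect-rowSum² {zero}      _       = refl
  perfect-rowSum² {suc m} {A} perfect = begin
    Σ< (suc m) A * Σ< (suc m) A                                     ≡⟨ Σ<-autocorr (suc m) periodic ⟨
    Σ< (suc m) (autocorr (suc m) A)                                 ≡⟨ Σ<-suc m (autocorr (suc m) A) ⟩
    autocorr (suc m) A 0 + Σ< m (λ t → autocorr (suc m) A (suc t))  ≡⟨ cong₂ _+_ peak offPeak ⟩
    + suc m + + 0                                                   ≡⟨ ℤₚ.+-identityʳ (+ suc m) ⟩
    + suc m                                                         ∎
    where
    open IsPerfect perfect
    peak : autocorr (suc m) A 0 ≡ + suc m
    peak = autocorr-period (suc m) isPM (periodic-0 A)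
    offPeak : Σ< m (λ t → autocorr (suc m) A (suc t)) ≡ + 0
    offPeak = trans (Σ<-cong m (λ t t<m → autocorr-offPeak (suc t) z<s (s<s t<m))) (Σ<-0 m)

  perfect-even : ∀ {n A} → IsPerfect n A → 1 < n → 2 ∣ n
  perfect-even {n} {A} perfect 1<n =
    Σ<-pm≡0⇒even n _ (λ i _ → pm-* (isPM i) (isPM (i ℕ.+ 1))) (autocorr-offPeak 1 z<s 1<n)
    where open IsPerfect perfect

  perfect-square : ∀ {n A} → IsPerfect n A → 1 < n → ∃ λ u → n ≡ 4 ℕ.* (u ℕ.* u)
  perfect-square {n} {A} perfect 1<n = q , (begin
    n                      ≡⟨ r²≡n ⟨
    ∣ r ∣ ℕ.* ∣ r ∣        ≡⟨ cong₂ ℕ._*_ r≡q*2 r≡q*2 ⟩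
    q ℕ.* 2 ℕ.* (q ℕ.* 2)  ≡⟨ double² q ⟩
    4 ℕ.* (q ℕ.* q)        ∎)
    where
    r : ℤ
    r = Σ< n A
    r²≡n : ∣ r ∣ ℕ.* ∣ r ∣ ≡ n
    r²≡n = trans (sym (ℤₚ.abs-* r r)) (cong ∣_∣ (perfect-rowSum² perfect))
    2∣r : 2 ∣ ∣ r ∣
    2∣r = reduce (euclidsLemma ∣ r ∣ ∣ r ∣ prime[2] (subst (2 ∣_) (sym r²≡n) (perfect-even perfect 1<n)))
    q : ℕ
    q = _∣_.quotient 2∣r
    r≡q*2 : ∣ r ∣ ≡ q ℕ.* 2
    r≡q*2 = _∣_.equality 2∣r
    double² : ∀ q → q ℕ.* 2 ℕ.* (q ℕ.* 2) ≡ 4 ℕ.* (q ℕ.* q)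
    double² = ℕ-solve-∀

  at-tabulate : ∀ {n} (f : ℕ → ℤ) {i} → i < n → at (tabulate {n = n} (λ k → f (toℕ k))) i ≡ f i
  at-tabulate f {zero}  (s<s _)   = refl
  at-tabulate f {suc i} (s<s i<n) = at-tabulate (f ∘ suc) i<n

  modN≡% : ∀ k n .{{_ : NonZero n}} → modN k n ≡ k % n
  modN≡% k (suc n) = refl

  rotation : (n : ℕ) → (ℕ → ℤ) → ℕ → Vec ℤ n
  rotation n A s = tabulate (λ i → A (toℕ i ℕ.+ s))

  θ-rotation : ∀ {n A} .{{_ : NonZero n}} → Periodic n A → ∀ s t → θ (rotation n A s) t ≡ autocorr n A t
  θ-rotation {n} {A} per s t = begin
    θ (rotation n A s) t                              ≡⟨ Σ<-cong n entries ⟩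
    Σ< n (λ i → A (i ℕ.+ s) * A (i ℕ.+ s ℕ.+ t))      ≡⟨ Σ<-rotate n (periodic-* per (periodic-shift per t)) s ⟩
    autocorr n A t                                    ∎
    where
    a : Vec ℤ n
    a = rotation n A s
    entries : ∀ i → i < n → at a i * at a (modN (i ℕ.+ t) n) ≡ A (i ℕ.+ s) * A (i ℕ.+ s ℕ.+ t)
    entries i i<n = cong₂ _*_ (at-tabulate (λ k → A (k ℕ.+ s)) i<n) (begin
      at a (modN (i ℕ.+ t) n)  ≡⟨ cong (at a) (modN≡% (i ℕ.+ t) n) ⟩
      at a ((i ℕ.+ t) % n)     ≡⟨ at-tabulate (λ k → A (k ℕ.+ s)) (m%n<n (i ℕ.+ t) n) ⟩
      A ((i ℕ.+ t) % n ℕ.+ s)  ≡⟨ periodic-% per (i ℕ.+ t) s ⟩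
      A (i ℕ.+ t ℕ.+ s)        ≡⟨ cong A (+-rightComm i t s) ⟩
      A (i ℕ.+ s ℕ.+ t)        ∎)

  IsBarker : ∀ {v} → Vec ℤ v → Set
  IsBarker {v} a = ∀ t → 0 < t → t < v → ∣ ρ a t ∣≤1

  PerfectIsBarker : ℕ → Set
  PerfectIsBarker v =
    (a : Vec ℤ v) → PMSeq v a → θ a 0 ≡ + v → (∀ t → modN t v ≢ 0 → θ a t ≡ + 0) → IsBarker a

  rotation-isBarker : ∀ {n A} .{{_ : NonZero n}} → PerfectIsBarker n → IsPerfect n A →
                      ∀ s → IsBarker (rotation n A s)
  rotation-isBarker {n} {A} perfectIsBarker perfect s =
    perfectIsBarker (rotation n A s) (tabulate⁺ (λ i → isPM (toℕ i ℕ.+ s))) peak offPeak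
    where
    open IsPerfect perfect
    peak : θ (rotation n A s) 0 ≡ + n
    peak = trans (θ-rotation periodic s 0) (autocorr-period n isPM (periodic-0 A))
    offPeak : ∀ t → modN t n ≢ 0 → θ (rotation n A s) t ≡ + 0
    offPeak t t≢0 = begin
      θ (rotation n A s) t  ≡⟨ θ-rotation periodic s t ⟩
      autocorr n A t        ≡⟨ autocorr-% periodic t ⟩
      autocorr n A (t % n)  ≡⟨ autocorr-offPeak (t % n) (ℕₚ.n≢0⇒n>0 (t≢0 ∘ trans (modN≡% t n))) (m%n<n t n) ⟩
      + 0                   ∎

  ρ-rotation : ∀ k (A : ℕ → ℤ) s →
               ρ (rotation (2 ℕ.+ k) A s) k ≡ A s * A (k ℕ.+ s) + A (1 ℕ.+ s) * A (suc k ℕ.+ s)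
  ρ-rotation k A s = begin
    ρ a k                                          ≡⟨ cong (λ l → Σ< l F) (ℕₚ.m+n∸n≡m 2 k) ⟩
    F 0 + (F 1 + + 0)                              ≡⟨ cong (_+_ (F 0)) (ℤₚ.+-identityʳ (F 1)) ⟩
    A s * at a k + A (1 ℕ.+ s) * at a (suc k)      ≡⟨ cong₂ (λ x y → A s * x + A (1 ℕ.+ s) * y)
                                                        (at-tabulate {2 ℕ.+ k} (λ i → A (i ℕ.+ s)) (ℕₚ.m<n+m k {2} z<s))
                                                        (at-tabulate {2 ℕ.+ k} (λ i → A (i ℕ.+ s)) (ℕₚ.n<1+n (suc k))) ⟩
    A s * A (k ℕ.+ s) + A (1 ℕ.+ s) * A (suc k ℕ.+ s)  ∎
    where
    a : Vec ℤ (2 ℕ.+ k)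
    a = rotation (2 ℕ.+ k) A s
    F : ℕ → ℤ
    F i = at a i * at a (i ℕ.+ k)

  barkerRotations⇒period4 : ∀ {n A} → IsPerfect n A → 2 < n → (∀ s → IsBarker (rotation n A s)) → Periodic 4 A
  barkerRotations⇒period4 {suc (suc k)} {A} perfect (s<s (s<s 0<k)) barker = pm-period4 isPM rel
    where
    open IsPerfect perfect
    ρ≡0 : ∀ s → A s * A (k ℕ.+ s) + A (1 ℕ.+ s) * A (suc k ℕ.+ s) ≡ + 0
    ρ≡0 s = pm+pm-∣∣≤1⇒≡0 (pm-* (isPM _) (isPM _)) (pm-* (isPM _) (isPM _))
              (subst ∣_∣≤1 (ρ-rotation k A s) (barker s k 0<k (ℕₚ.m<n+m k z<s)))
    wrap : ∀ x y → x ℕ.+ (2 ℕ.+ y) ≡ y ℕ.+ (2 ℕ.+ x)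
    wrap x y = trans (ℕₚ.+-comm x (2 ℕ.+ y)) (trans (cong (2 ℕ.+_) (ℕₚ.+-comm y x)) (ℕₚ.+-comm (2 ℕ.+ x) y))
    rel : ∀ j → A (2 ℕ.+ j) * A j + A (3 ℕ.+ j) * A (1 ℕ.+ j) ≡ + 0
    rel j = begin
      A (2 ℕ.+ j) * A j + A (3 ℕ.+ j) * A (1 ℕ.+ j)
        ≡⟨ cong₂ (λ x y → A (2 ℕ.+ j) * x + A (3 ℕ.+ j) * y)
             (trans (cong A (wrap k j)) (periodic j))
             (trans (cong (A ∘ suc) (wrap k j)) (periodic (1 ℕ.+ j))) ⟨
      A (2 ℕ.+ j) * A (k ℕ.+ (2 ℕ.+ j)) + A (3 ℕ.+ j) * A (suc k ℕ.+ (2 ℕ.+ j))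
        ≡⟨ ρ≡0 (2 ℕ.+ j) ⟩
      + 0 ∎

  perfect-period4⇒≤4 : ∀ {n A} → IsPerfect n A → Periodic 4 A → n ≤ 4
  perfect-period4⇒≤4 {n} {A} perfect per4 = ℕₚ.≮⇒≥ λ 4<n →
    ℕₚ.m<n⇒n≢0 4<n (ℤₚ.+-injective (trans (sym (autocorr-period n isPM per4)) (autocorr-offPeak 4 z<s 4<n)))
    where open IsPerfect perfect

  4<4u² : ∀ {u} → 2 ≤ u → 4 < 4 ℕ.* (u ℕ.* u)
  4<4u² 2≤u = ℕₚ.<-≤-trans (ℕₚ.m<m+n 4 {12} z<s) (ℕₚ.*-monoʳ-≤ 4 (ℕₚ.*-mono-≤ 2≤u 2≤u))

  perfect-order : (∀ u → 1 ≤ u → PerfectIsBarker (4 ℕ.* (u ℕ.* u))) →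
                  ∀ {m A} → IsPerfect (2 ℕ.+ m) A → 2 ℕ.+ m ≡ 4
  perfect-order hyp {m} {A} perfect = order (perfect-square perfect (s<s z<s))
    where
    order : (∃ λ u → 2 ℕ.+ m ≡ 4 ℕ.* (u ℕ.* u)) → 2 ℕ.+ m ≡ 4
    order (zero            , ())
    order (suc zero        , n≡4)   = n≡4
    order (u@(suc (suc _)) , n≡4u²) = ⊥-elim (ℕₚ.<⇒≱ 4<n (perfect-period4⇒≤4 perfect period4))
      where
      4<n : 4 < 2 ℕ.+ m
      4<n = subst (4 <_) (sym n≡4u²) (4<4u² {u} (s≤s (s≤s z≤n)))
      period4 : Periodic 4 A
      period4 = barkerRotations⇒period4 perfect (ℕₚ.<-trans (s<s (s<s z<s)) 4<n)
        (rotation-isBarker (subst PerfectIsBarker (sym n≡4u²) (hyp u z<s)) perfect)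

  δ-≢ : ∀ {i k} z → i ≢ k → δ i k z ≡ + 0
  δ-≢ {i} {k} z i≢k with i ℕ.≟ k
  ... | yes i≡k = contradiction i≡k i≢k
  ... | no  _   = refl

  periodicFirstRow : ∀ {n} → Mat n → ℕ → ℤ
  periodicFirstRow {n} H i = ent H 0 (modN i n)

  cyclicHadamard⇒perfect : ∀ {m} (H : Mat (suc m)) → IsCyclicHadamard (suc m) H →
                           IsPerfect (suc m) (periodicFirstRow H)
  cyclicHadamard⇒perfect {m} H (pm , cyclic , orthogonal) = record
    { isPM             = λ i → pm 0 (i % suc m) z<s (m%n<n i (suc m))
    ; periodic         = λ i → cong (ent H 0) ([m+n]%n≡m%n i (suc m))
    ; autocorr-offPeak = offPeak
    }
    where
    n : ℕ
    n = suc m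
    A : ℕ → ℤ
    A = periodicFirstRow H
    -- The rows 0 and n − t of H are orthogonal, and row n − t is the first row shifted by t.
    offPeak : ∀ t → 0 < t → t < n → autocorr n A t ≡ + 0
    offPeak t 0<t t<n = begin
      autocorr n A t                            ≡⟨ Σ<-cong n entries ⟨
      Σ< n (λ j → ent H 0 j * ent H (n ∸ t) j)  ≡⟨ orthogonal 0 (n ∸ t) z<s n∸t<n ⟩
      δ 0 (n ∸ t) (+ n)                         ≡⟨ δ-≢ (+ n) (ℕₚ.<⇒≢ (ℕₚ.m<n⇒0<n∸m t<n)) ⟩
      + 0                                       ∎
      where
      n∸t<n : n ∸ t < n
      n∸t<n = ℕₚ.∸-monoʳ-< 0<t (ℕₚ.<⇒≤ t<n)
      shift : ∀ j → j ℕ.+ n ∸ (n ∸ t) ≡ j ℕ.+ t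
      shift j = trans (ℕₚ.+-∸-assoc j (ℕₚ.m∸n≤m n t)) (cong (j ℕ.+_) (ℕₚ.m∸[m∸n]≡n (ℕₚ.<⇒≤ t<n)))
      entries : ∀ j → j < n → ent H 0 j * ent H (n ∸ t) j ≡ A j * A (j ℕ.+ t)
      entries j j<n = cong₂ _*_ (cong (ent H 0) (sym (m<n⇒m%n≡m j<n)))
                                (trans (cyclic (n ∸ t) j n∸t<n j<n) (cong A (shift j)))

  cyclicHadamard-order : (∀ u → 1 ≤ u → PerfectIsBarker (4 ℕ.* (u ℕ.* u))) →
                         ∀ {n} (H : Mat n) → IsCyclicHadamard n H → n ≡ 0 ⊎ n ≡ 1 ⊎ n ≡ 4
  cyclicHadamard-order hyp {zero}        _ _  = inj₁ refl
  cyclicHadamard-order hyp {suc zero}    _ _  = inj₂ (inj₁ refl)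
  cyclicHadamard-order hyp {suc (suc m)} H hc = inj₂ (inj₂ (perfect-order hyp (cyclicHadamard⇒perfect H hc)))

  atRow-tabulate : ∀ {m n} (f : ℕ → Vec ℤ n) {i} → i < m → atRow (tabulate {n = m} (λ k → f (toℕ k))) i ≡ f i
  atRow-tabulate f {zero}  (s<s _)   = refl
  atRow-tabulate f {suc i} (s<s i<m) = atRow-tabulate (f ∘ suc) i<m

  at-ext : ∀ {n} (u v : Vec ℤ n) → (∀ i → i < n → at u i ≡ at v i) → u ≡ v
  at-ext []      []      _   = refl
  at-ext (x ∷ u) (y ∷ v) u≗v = cong₂ _∷_ (u≗v 0 z<s) (at-ext u v (λ i i<n → u≗v (suc i) (s<s i<n)))

  atRow-ext : ∀ {m n} (M N : Vec (Vec ℤ n) m) → (∀ i → i < m → atRow M i ≡ atRow N i) → M ≡ N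
  atRow-ext []      []      _   = refl
  atRow-ext (r ∷ M) (s ∷ N) M≗N = cong₂ _∷_ (M≗N 0 z<s) (atRow-ext M N (λ i i<m → M≗N (suc i) (s<s i<m)))

  ent-ext : ∀ {n} (M N : Mat n) → (∀ i j → i < n → j < n → ent M i j ≡ ent N i j) → M ≡ N
  ent-ext M N M≗N = atRow-ext M N (λ i i<n → at-ext (atRow M i) (atRow N i) (λ j j<n → M≗N i j i<n j<n))

  All-at : ∀ {n} {P : ℤ → Set} (v : Vec ℤ n) → (∀ i → i < n → P (at v i)) → VAll.All P v
  All-at []      _  = VAll.[]
  All-at (x ∷ v) Pv = Pv 0 z<s VAll.∷ All-at v (λ i i<n → Pv (suc i) (s<s i<n))

  circulantRow : ∀ {n} → Vec ℤ n → ℕ → Vec ℤ n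
  circulantRow {n} a i = tabulate (λ j → at a (modN (toℕ j ℕ.+ n ∸ i) n))

  circulant : ∀ {n} → Vec ℤ n → Mat n
  circulant a = tabulate (λ i → circulantRow a (toℕ i))

  ent-circulant : ∀ {n} (a : Vec ℤ n) {i j} → i < n → j < n → ent (circulant a) i j ≡ at a (modN (j ℕ.+ n ∸ i) n)
  ent-circulant {n} a {i} {j} i<n j<n = begin
    at (atRow (circulant a) i) j  ≡⟨ cong (λ r → at r j) (atRow-tabulate (circulantRow a) i<n) ⟩
    at (circulantRow a i) j       ≡⟨ at-tabulate (λ k → at a (modN (k ℕ.+ n ∸ i) n)) j<n ⟩
    at a (modN (j ℕ.+ n ∸ i) n)   ∎

  cyclic≡circulant : ∀ {n} {H : Mat n} → (∀ i j → i < n → j < n → ent H i j ≡ ent H 0 (modN (j ℕ.+ n ∸ i) n)) →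
                     H ≡ circulant (atRow H 0)
  cyclic≡circulant {H = H} cyclic =
    ent-ext H _ (λ i j i<n j<n → trans (cyclic i j i<n j<n) (sym (ent-circulant (atRow H 0) i<n j<n)))

  pmVecs : (n : ℕ) → List (Vec ℤ n)
  pmVecs zero    = [] ∷ []
  pmVecs (suc n) = cartesianProductWith _∷_ (+ 1 ∷ - (+ 1) ∷ []) (pmVecs n)

  ∈-pmVecs : ∀ {n} {v : Vec ℤ n} → PMSeq n v → v ∈ pmVecs n
  ∈-pmVecs VAll.[]          = here refl
  ∈-pmVecs (x±1 VAll.∷ v±1) = ∈-cartesianProductWith⁺ _∷_ (pm∈ x±1) (∈-pmVecs v±1)
    where
    pm∈ : ∀ {x} → IsPM x → x ∈ + 1 ∷ - (+ 1) ∷ []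
    pm∈ (inj₁ refl) = here refl
    pm∈ (inj₂ refl) = there (here refl)

  circulants : ℕ → List (Σ ℕ Mat)
  circulants n = map (λ a → n , circulant a) (pmVecs n)

  cyclicHadamard∈circulants : ∀ {n} (H : Mat n) → IsCyclicHadamard n H → (n , H) ∈ circulants n
  cyclicHadamard∈circulants {n} H (pm , cyclic , _) =
    subst (λ M → (n , M) ∈ circulants n) (sym (cyclic≡circulant cyclic))
      (∈-map⁺ (λ a → n , circulant a) (∈-pmVecs (All-at (atRow H 0) firstRow±1)))
    where
    firstRow±1 : ∀ j → j < n → IsPM (ent H 0 j)
    firstRow±1 j j<n = pm 0 j (ℕₚ.<-≤-trans z<s j<n) j<n

open CyclicHadamard using (circulants; cyclicHadamard-order; cyclicHadamard∈circulants)

open import Defs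
open import Data.Nat using (ℕ; _*_; _<_; _≤_)
open import Data.Integer using (ℤ; +_; -_)
open import Data.List using (List; _++_)
import Data.Vec
open import Data.List.Membership.Propositional using (_∈_)
open import Data.List.Membership.Propositional.Properties using (∈-++⁺ˡ; ∈-++⁺ʳ)
open import Data.Product using (Σ; ∃; _,_)
open import Data.Sum using (_⊎_; inj₁; inj₂)
open import Relation.Binary.PropositionalEquality using (_≡_; _≢_; refl)

theorem25 :
  (∀ (u : ℕ) → 1 ≤ u → (a : Data.Vec.Vec ℤ (4 * (u * u))) → PMSeq (4 * (u * u)) a →
    θ a 0 ≡ + (4 * (u * u)) →
    (∀ (t : ℕ) → modN t (4 * (u * u)) ≢ 0 → θ a t ≡ + 0) →
    ∀ (t : ℕ) → 0 < t → t < 4 * (u * u) →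
      (ρ a t ≡ + 0 ⊎ ρ a t ≡ + 1 ⊎ ρ a t ≡ - (+ 1))) →
  ∃ λ (L : List (Σ ℕ Mat)) →
    ∀ (n : ℕ) (H : Mat n) → IsCyclicHadamard n H → (n , H) ∈ L
theorem25 hyp =
  circulants 0 ++ circulants 1 ++ circulants 4 , λ n H hc → byOrder H hc (cyclicHadamard-order hyp H hc)
  where
  byOrder : ∀ {n} (H : Mat n) → IsCyclicHadamard n H → n ≡ 0 ⊎ n ≡ 1 ⊎ n ≡ 4 →
            (n , H) ∈ circulants 0 ++ circulants 1 ++ circulants 4
  byOrder H hc (inj₁ refl)        = ∈-++⁺ˡ (cyclicHadamard∈circulants H hc)
  byOrder H hc (inj₂ (inj₁ refl)) = ∈-++⁺ʳ (circulants 0) (∈-++⁺ˡ (cyclicHadamard∈circulants H hc))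
  byOrder H hc (inj₂ (inj₂ refl)) = ∈-++⁺ʳ (circulants 0) (∈-++⁺ʳ (circulants 1) (cyclicHadamard∈circulants H hc))
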